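{- Let $X$ be a finite set with $|X|\ge3$ and $c$ an imbalanced partial choice function on pairs from $X$. Then $c$ is partisan if and only if $V_1(c)$ lies on a line parallel to the line $y=x$ and $V_0(c)$ is contained in the line $y=x$.
   Context: A partial choice function is a map $c$ from a set of 2-element subsets of $X$ with $c\{x,y\}\in\{x,y\}$. $W^x_y(c)$ is $1$ if $c\{x,y\}=x$, $-1$ if $c\{x,y\}=y$, $0$ if $\{x,y\}\notin\operatorname{dom}c$ (including $x=y$). The valence of $x$ is $\operatorname{val}_c(x)=\sum_{y\in X}W^x_y(c)$; $c$ is balanced if all valences are $0$, imbalanced otherwise. For $\ell\in\{ -1,0,1\}$, $V_\ell(c)=\{(\operatorname{val}_c(x)-\ell,\ \operatorname{val}_c(y)+\ell): x,y\in X,\ x\ne y,\ W^x_y(c)=\ell\}\subseteq\mathbb{Q}\times\mathbb{Q}$. $c$ is partisan if there is nonempty $W\subsetneq X$ with $c\{x,y\}=x\iff(x\in W\text{ and }y\notin W)$. -}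

module Defs where

open import Data.Nat using (ℕ; zero; suc)
open import Data.Fin using (Fin; _≟_) renaming (zero to fz; suc to fs)
open import Data.Integer using (ℤ; +_; -_; _+_; _-_)
open import Data.Maybe using (Maybe; just; nothing)
open import Data.Bool using (Bool; true; false; if_then_else_)
open import Data.Product using (_×_; Σ; ∃; ∃-syntax; _,_)
open import Data.Sum using (_⊎_)
open import Relation.Nullary using (¬_; does)
open import Relation.Binary.PropositionalEquality using (_≡_; _≢_)
open import Function.Bundles using (_⇔_)

-- The unordered pair
-- {x,y} is represented symmetrically: choose x y = choose y x.
-- choose x y = nothing  means {x,y} ∉ dom c  (always the case when x = y,
-- since {x,x} is not a 2-element subset);  choose x y = just z means
-- {x,y} ∈ dom c and c{x,y} = z, where z ∈ {x,y}.
record PartialChoice (n : ℕ) : Set where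
  field
    choose : Fin n → Fin n → Maybe (Fin n)
    choose-sym : ∀ x y → choose x y ≡ choose y x
    choose-diag : ∀ x → choose x x ≡ nothing
    choose-valid : ∀ x y z → choose x y ≡ just z → (z ≡ x) ⊎ (z ≡ y)
open PartialChoice public

W : ∀ {n} → PartialChoice n → Fin n → Fin n → ℤ
W c x y with choose c x y
... | nothing = + 0
... | just z = if does (z ≟ x) then + 1 else - (+ 1)

sumFin : ∀ n → (Fin n → ℤ) → ℤ
sumFin zero f = + 0
sumFin (suc n) f = f fz + sumFin n (λ i → f (fs i))

val : ∀ {n} → PartialChoice n → Fin n → ℤ
val {n} c x = sumFin n (λ y → W c x y)

Balanced : ∀ {n} → PartialChoice n → Set
Balanced c = ∀ x → val c x ≡ + 0

Imbalanced : ∀ {n} → PartialChoice n → Set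
Imbalanced c = ¬ Balanced c

InV : ∀ {n} → PartialChoice n → ℤ → ℤ × ℤ → Set
InV {n} c ℓ (a , b) =
  ∃[ x ] ∃[ y ] (x ≢ y × W c x y ≡ ℓ × a ≡ val c x - ℓ × b ≡ val c y + ℓ)

OnLineParallelToDiagonal : (ℤ × ℤ → Set) → Set
OnLineParallelToDiagonal S = ∃[ d ] (∀ a b → S (a , b) → b - a ≡ d)

OnDiagonal : (ℤ × ℤ → Set) → Set
OnDiagonal S = ∀ a b → S (a , b) → a ≡ b

Partisan : ∀ {n} → PartialChoice n → Set
Partisan {n} c = Σ (Fin n → Bool) λ Ws → ((∃[ x ] Ws x ≡ true) × (∃[ x ] Ws x ≡ false) ×
  (∀ x y → (choose c x y ≡ just x) ⇔ (Ws x ≡ true × Ws y ≡ false)))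

module Submission where

-- Write W x y for the weight W^x_y(c) and V x for the valence of x.  Call a
-- colouring Ws : X → Bool a *split* of c when W x y = ⟦Ws x⟧ - ⟦Ws y⟧ for all
-- x, y (with ⟦true⟧ = 1, ⟦false⟧ = 0).  The whole proof runs through splits.
--
-- * c is partisan with winning set Ws exactly when Ws splits c
--   (partisan⇔splits), since W x y = 1 iff c{x,y} = x.
-- * If Ws splits c, then V x = Σ_y (⟦Ws x⟧ - ⟦Ws y⟧) depends only on Ws x.
--   A point of V₁ comes from a pair with Ws x = true, Ws y = false, so V₁ is
--   a single point; a point of V₀ comes from Ws x = Ws y, so it is diagonal.
-- * Conversely, if V₁ lies on the line y - x = d and V₀ on the diagonal, then
--   V x - V y = W x y · δ for all x, y, where δ = 2 - d (gap).  Valences sum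
--   to 0, so δ = 0 would make c balanced; hence δ ≠ 0 and W is a potential
--   difference, W x y = W x a - W y a.  Taking an edge a → b (it exists as c
--   is imbalanced) forces W x a ∈ {0, -1}, and Ws x := [W x a = 0] splits c.

open import Defs
open import Data.Nat using (ℕ; _≤_; zero; suc)
open import Data.Integer using (ℤ; +_; -_; _+_; _-_; _*_; ≢-nonZero)
import Data.Integer as ℤ
open import Data.Integer.Properties
  using (+-0-commutativeMonoid; suc-*; *-identityˡ; *-zeroʳ; +-identityʳ; +-inverseˡ; +-inverseʳ;
         +-injective; i≡j⇒i-j≡0; i-j≡0⇒i≡j; i*j≡0⇒i≡0∨j≡0; *-cancelʳ-≡)
open import Data.Integer.Tactic.RingSolver using (solve-∀)
open import Algebra.Properties.CommutativeMonoid.Sum +-0-commutativeMonoid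
  using (sum; sum-syntax; ∑-comm; ∑-distrib-+; sum-cong-≗; sum-replicate-zero)
open import Data.Fin using (Fin; _≟_) renaming (zero to fz; suc to fs)
open import Data.Fin.Properties using (any?; ¬Fin0)
open import Data.Maybe using (just; nothing)
open import Data.Bool using (Bool; true; false)
open import Data.Product using (_×_; ∃-syntax; _,_; proj₁; proj₂)
open import Data.Sum using (_⊎_; inj₁; inj₂)
open import Data.Empty using (⊥-elim)
open import Function using (_∘_)
open import Function.Bundles using (_⇔_; mk⇔; Equivalence)
open import Relation.Nullary using (yes; no)
open import Relation.Nullary.Decidable using (dec-true; dec-false)
open import Relation.Binary.PropositionalEquality
open Equivalence using (to; from)
open ≡-Reasoning

IsSign : ℤ → Set
IsSign i = i ≡ + 1 ⊎ i ≡ + 0 ⊎ i ≡ - + 1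

sign-below-sign : ∀ {i} → IsSign i → IsSign (i + + 1) → i ≡ + 0 ⊎ i ≡ - + 1
sign-below-sign (inj₁ refl) (inj₁ ())
sign-below-sign (inj₁ refl) (inj₂ (inj₁ ()))
sign-below-sign (inj₁ refl) (inj₂ (inj₂ ()))
sign-below-sign (inj₂ zero-or-neg) _ = zero-or-neg

double-zero : ∀ i → i + i ≡ + 0 → i ≡ + 0
double-zero i i+i≡0 with i*j≡0⇒i≡0∨j≡0 (+ 2) (trans (doubling i) i+i≡0)
  where
  doubling : ∀ i → + 2 * i ≡ i + i
  doubling = solve-∀
... | inj₁ ()
... | inj₂ i≡0 = i≡0

⟦_⟧ : Bool → ℤ
⟦ true ⟧ = + 1
⟦ false ⟧ = + 0

⟦⟧-diff-one : ∀ p q → (⟦ p ⟧ - ⟦ q ⟧ ≡ + 1) ⇔ (p ≡ true × q ≡ false)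
⟦⟧-diff-one p q = mk⇔ (forward p q) λ { (refl , refl) → refl }
  where
  forward : ∀ p q → ⟦ p ⟧ - ⟦ q ⟧ ≡ + 1 → p ≡ true × q ≡ false
  forward true false _ = refl , refl
  forward true true ()
  forward false false ()
  forward false true ()

⟦⟧-diff-zero : ∀ p q → ⟦ p ⟧ - ⟦ q ⟧ ≡ + 0 → p ≡ q
⟦⟧-diff-zero true true _ = refl
⟦⟧-diff-zero false false _ = refl
⟦⟧-diff-zero true false ()
⟦⟧-diff-zero false true ()

isZero : ∀ {i} → i ≡ + 0 ⊎ i ≡ - + 1 → Bool
isZero (inj₁ _) = true
isZero (inj₂ _) = false

isZero-spec : ∀ {i} (zero-or-neg : i ≡ + 0 ⊎ i ≡ - + 1) → i ≡ ⟦ isZero zero-or-neg ⟧ - + 1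
isZero-spec (inj₁ refl) = refl
isZero-spec (inj₂ refl) = refl

sumFin≡sum : ∀ n (f : Fin n → ℤ) → sumFin n f ≡ sum f
sumFin≡sum zero f = refl
sumFin≡sum (suc n) f = cong (λ s → f fz + s) (sumFin≡sum n (f ∘ fs))

sum-const : ∀ n k → ∑[ i < n ] k ≡ + n * k
sum-const zero k = refl
sum-const (suc n) k = trans (cong (λ s → k + s) (sum-const n k)) (sym (suc-* (+ n) k))

module _ {n : ℕ} (c : PartialChoice n) where

  W-sign : ∀ x y → IsSign (W c x y)
  W-sign x y with choose c x y
  ... | nothing = inj₂ (inj₁ refl)
  ... | just z with z ≟ x
  ...   | yes _ = inj₁ refl
  ...   | no _ = inj₂ (inj₂ refl)

  W-one→ : ∀ x y → W c x y ≡ + 1 → choose c x y ≡ just x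
  W-one→ x y with choose c x y
  ... | nothing = λ ()
  ... | just z with z ≟ x
  ...   | yes refl = λ _ → refl
  ...   | no _ = λ ()

  W-one← : ∀ x y → choose c x y ≡ just x → W c x y ≡ + 1
  W-one← x y x-chosen rewrite x-chosen | dec-true (x ≟ x) refl = refl

  W-diag : ∀ x → W c x x ≡ + 0
  W-diag x rewrite choose-diag c x = refl

  choice-distinct : ∀ x y z → choose c x y ≡ just z → x ≢ y
  choice-distinct x .x z chosen refl with () ← trans (sym chosen) (choose-diag c x)

  W-anti : ∀ x y → W c x y ≡ - W c y x
  W-anti x y rewrite choose-sym c y x with choose c x y in chosen
  ... | nothing = refl
  ... | just z with choose-valid c x y z chosen | choice-distinct x y z chosen
  ...   | inj₁ refl | x≢y rewrite dec-true (x ≟ x) refl | dec-false (x ≟ y) x≢y = refl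
  ...   | inj₂ refl | x≢y rewrite dec-true (y ≟ y) refl | dec-false (y ≟ x) (x≢y ∘ sym) = refl

  W-zero : ∀ x y → W c x y ≢ + 1 → W c y x ≢ + 1 → W c x y ≡ + 0
  W-zero x y x-loses y-loses with W-sign x y
  ... | inj₁ x-wins = ⊥-elim (x-loses x-wins)
  ... | inj₂ (inj₁ zero-weight) = zero-weight
  ... | inj₂ (inj₂ y-wins) = ⊥-elim (y-loses (trans (W-anti y x) (cong -_ y-wins)))

  valence-sum : ∀ x → val c x ≡ ∑[ y < n ] W c x y
  valence-sum x = sumFin≡sum n (W c x)

  -- Every decided pair adds +1 to one valence and -1 to the other.
  valences-sum-to-zero : ∑[ x < n ] val c x ≡ + 0
  valences-sum-to-zero = trans (sum-cong-≗ valence-sum) (double-zero total twice-total)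
    where
    total : ℤ
    total = ∑[ x < n ] ∑[ y < n ] W c x y
    twice-total : total + total ≡ + 0
    twice-total = begin
      total + total
        ≡⟨ cong (λ s → total + s) (∑-comm (W c)) ⟩
      total + ∑[ x < n ] ∑[ y < n ] W c y x
        ≡⟨ ∑-distrib-+ (λ x → ∑[ y < n ] W c x y) (λ x → ∑[ y < n ] W c y x) ⟨
      ∑[ x < n ] (∑[ y < n ] W c x y + ∑[ y < n ] W c y x)
        ≡⟨ sum-cong-≗ (λ x → ∑-distrib-+ (W c x) (λ y → W c y x)) ⟨
      ∑[ x < n ] ∑[ y < n ] (W c x y + W c y x)
        ≡⟨ sum-cong-≗ (λ x → sum-cong-≗ (λ y → opposite x y)) ⟩
      ∑[ x < n ] ∑[ y < n ] (+ 0)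
        ≡⟨ sum-cong-≗ {n} (λ _ → sum-replicate-zero n) ⟩
      ∑[ x < n ] (+ 0)
        ≡⟨ sum-replicate-zero n ⟩
      + 0 ∎
      where
      opposite : ∀ x y → W c x y + W c y x ≡ + 0
      opposite x y = trans (cong (_+ W c y x) (W-anti x y)) (+-inverseˡ (W c y x))

  no-edge→balanced : (∀ x y → W c x y ≢ + 1) → Balanced c
  no-edge→balanced no-edge x = begin
    val c x                ≡⟨ valence-sum x ⟩
    ∑[ y < n ] W c x y     ≡⟨ sum-cong-≗ (λ y → W-zero x y (no-edge x y) (no-edge y x)) ⟩
    ∑[ y < n ] (+ 0)         ≡⟨ sum-replicate-zero n ⟩
    + 0                    ∎

  -- Since valences sum to zero, constant valences are all zero.
  constant→balanced : (∀ x y → val c x ≡ val c y) → Balanced c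
  constant→balanced constant x with i*j≡0⇒i≡0∨j≡0 (+ n) n·val≡0
    where
    n·val≡0 : + n * val c x ≡ + 0
    n·val≡0 = begin
      + n * val c x           ≡⟨ sum-const n (val c x) ⟨
      ∑[ y < n ] val c x      ≡⟨ sum-cong-≗ (constant x) ⟩
      ∑[ y < n ] val c y      ≡⟨ valences-sum-to-zero ⟩
      + 0                     ∎
  ... | inj₁ n≡0 = ⊥-elim (¬Fin0 (subst Fin (+-injective n≡0) x))
  ... | inj₂ val≡0 = val≡0

  edge : Imbalanced c → ∃[ a ] ∃[ b ] W c a b ≡ + 1
  edge imbalanced with any? (λ a → any? (λ b → W c a b ℤ.≟ + 1))
  ... | yes a→b = a→b
  ... | no no-edge = ⊥-elim (imbalanced (no-edge→balanced (λ a b w → no-edge (a , b , w))))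

Splits : ∀ {n} → PartialChoice n → (Fin n → Bool) → Set
Splits c Ws = ∀ x y → W c x y ≡ ⟦ Ws x ⟧ - ⟦ Ws y ⟧

partisan⇔splits : ∀ {n} (c : PartialChoice n) (Ws : Fin n → Bool) →
  (∀ x y → (choose c x y ≡ just x) ⇔ (Ws x ≡ true × Ws y ≡ false)) ⇔ Splits c Ws
partisan⇔splits c Ws = mk⇔ winners→splits splits→winners
  where
  Winners : Set
  Winners = ∀ x y → (choose c x y ≡ just x) ⇔ (Ws x ≡ true × Ws y ≡ false)

  same-side : Winners → ∀ u v → Ws u ≡ Ws v → W c u v ≢ + 1
  same-side wins u v same u-wins with to (wins u v) (W-one→ c u v u-wins)
  ... | u-in , v-out with () ← trans (sym u-in) (trans same v-out)

  winners→splits : Winners → Splits c Ws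
  winners→splits wins x y with Ws x in x-side | Ws y in y-side
  ... | true | false = W-one← c x y (from (wins x y) (x-side , y-side))
  ... | false | true = trans (W-anti c x y) (cong -_ (W-one← c y x (from (wins y x) (y-side , x-side))))
  ... | true | true = W-zero c x y (same-side wins x y (trans x-side (sym y-side)))
                                   (same-side wins y x (trans y-side (sym x-side)))
  ... | false | false = W-zero c x y (same-side wins x y (trans x-side (sym y-side)))
                                     (same-side wins y x (trans y-side (sym x-side)))

  splits→winners : Splits c Ws → Winners
  splits→winners split x y = mk⇔
    (λ x-chosen → to (⟦⟧-diff-one (Ws x) (Ws y)) (trans (sym (split x y)) (W-one← c x y x-chosen)))
    (λ sides → W-one→ c x y (trans (split x y) (from (⟦⟧-diff-one (Ws x) (Ws y)) sides)))

module SplitGeometry {n : ℕ} (c : PartialChoice n) (Ws : Fin n → Bool) (split : Splits c Ws) where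

  sideValence : Bool → ℤ
  sideValence p = ∑[ y < n ] (⟦ p ⟧ - ⟦ Ws y ⟧)

  val≡sideValence : ∀ x → val c x ≡ sideValence (Ws x)
  val≡sideValence x = trans (valence-sum c x) (sum-cong-≗ (split x))

  V₁-line : OnLineParallelToDiagonal (InV c (+ 1))
  V₁-line = (sideValence false + + 1) - (sideValence true - + 1) , on-line
    where
    on-line : ∀ a b → InV c (+ 1) (a , b) → b - a ≡ (sideValence false + + 1) - (sideValence true - + 1)
    on-line _ _ (x , y , _ , x-wins , refl , refl)
      with x-in , y-out ← to (⟦⟧-diff-one (Ws x) (Ws y)) (trans (sym (split x y)) x-wins)
      rewrite val≡sideValence x | val≡sideValence y | x-in | y-out = refl

  V₀-diagonal : OnDiagonal (InV c (+ 0))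
  V₀-diagonal _ _ (x , y , _ , undecided , refl , refl) = cong (_+ + 0) (begin
    val c x             ≡⟨ val≡sideValence x ⟩
    sideValence (Ws x)  ≡⟨ cong sideValence (⟦⟧-diff-zero (Ws x) (Ws y) (trans (sym (split x y)) undecided)) ⟩
    sideValence (Ws y)  ≡⟨ val≡sideValence y ⟨
    val c y             ∎)

module Converse {n : ℕ} (c : PartialChoice n) (imbalanced : Imbalanced c) (d : ℤ)
  (on-line : ∀ a b → InV c (+ 1) (a , b) → b - a ≡ d) (on-diagonal : OnDiagonal (InV c (+ 0))) where

  V : Fin n → ℤ
  V = val c

  δ : ℤ
  δ = + 2 - d

  edge-gap : ∀ x y → W c x y ≡ + 1 → V x - V y ≡ δ
  edge-gap x y x-wins = trans (shift (V x) (V y)) (cong (λ s → + 2 - s) (on-line _ _ (x , y , x≢y , x-wins , refl , refl)))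
    where
    x≢y : x ≢ y
    x≢y = choice-distinct c x y x (W-one→ c x y x-wins)
    shift : ∀ p q → p - q ≡ + 2 - ((q + + 1) - (p - + 1))
    shift = solve-∀

  -- Valences differ by W x y · δ: by δ along edges (from V₁), by 0 across
  -- undecided pairs (from V₀).
  gap : ∀ x y → V x - V y ≡ W c x y * δ
  gap x y with W-sign c x y
  ... | inj₁ x-wins rewrite x-wins = trans (edge-gap x y x-wins) (sym (*-identityˡ δ))
  ... | inj₂ (inj₂ y-wins) rewrite y-wins =
    trans (reverse (V x) (V y)) (cong (λ s → - + 1 * s) (edge-gap y x (trans (W-anti c y x) (cong -_ y-wins))))
    where
    reverse : ∀ p q → p - q ≡ - + 1 * (q - p)
    reverse = solve-∀
  ... | inj₂ (inj₁ undecided) rewrite undecided with x ≟ y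
  ...   | yes refl = +-inverseʳ (V x)
  ...   | no x≢y = i≡j⇒i-j≡0 (trans (sym (+-identityʳ (V x)))
                     (trans (on-diagonal _ _ (x , y , x≢y , undecided , refl , refl)) (+-identityʳ (V y))))

  -- δ = 0 would make all valences equal, hence c balanced.
  δ≢0 : δ ≢ + 0
  δ≢0 δ≡0 = imbalanced (constant→balanced c λ x y →
    i-j≡0⇒i≡j (V x) (V y) (trans (gap x y) (trans (cong (λ s → W c x y * s) δ≡0) (*-zeroʳ (W c x y)))))

  a b : Fin n
  a = proj₁ (edge c imbalanced)
  b = proj₁ (proj₂ (edge c imbalanced))

  a-beats-b : W c a b ≡ + 1
  a-beats-b = proj₂ (proj₂ (edge c imbalanced))

  -- Because δ ≠ 0, the weights are differences of a potential x ↦ W x a.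
  W-via-a : ∀ x y → W c x y ≡ W c x a - W c y a
  W-via-a x y = *-cancelʳ-≡ (W c x y) (W c x a - W c y a) δ {{≢-nonZero δ≢0}} (begin
    W c x y * δ                ≡⟨ gap x y ⟨
    V x - V y                  ≡⟨ through (V x) (V y) (V a) ⟩
    (V x - V a) - (V y - V a)  ≡⟨ cong₂ _-_ (gap x a) (gap y a) ⟩
    W c x a * δ - W c y a * δ  ≡⟨ factor (W c x a) (W c y a) δ ⟩
    (W c x a - W c y a) * δ    ∎)
    where
    through : ∀ p q r → p - q ≡ (p - r) - (q - r)
    through = solve-∀
    factor : ∀ s t e → s * e - t * e ≡ (s - t) * e
    factor = solve-∀

  -- Nobody beats a, since W x b = W x a + 1 must again be a weight.
  W-toward-a : ∀ x → W c x a ≡ + 0 ⊎ W c x a ≡ - + 1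
  W-toward-a x = sign-below-sign (W-sign c x a)
    (subst IsSign (trans (W-via-a x b) (cong (λ s → W c x a - s) b-loses-to-a)) (W-sign c x b))
    where
    b-loses-to-a : W c b a ≡ - + 1
    b-loses-to-a = trans (W-anti c b a) (cong -_ a-beats-b)

  side : Fin n → Bool
  side x = isZero (W-toward-a x)

  split : Splits c side
  split x y = begin
    W c x y                                    ≡⟨ W-via-a x y ⟩
    W c x a - W c y a                          ≡⟨ cong₂ _-_ (isZero-spec (W-toward-a x)) (isZero-spec (W-toward-a y)) ⟩
    (⟦ side x ⟧ - + 1) - (⟦ side y ⟧ - + 1)    ≡⟨ cancel ⟦ side x ⟧ ⟦ side y ⟧ ⟩
    ⟦ side x ⟧ - ⟦ side y ⟧                    ∎
    where
    cancel : ∀ p q → (p - + 1) - (q - + 1) ≡ p - q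
    cancel = solve-∀

  partisan : Partisan c
  partisan = side , (a , a-in) , (b , b-out) , from (partisan⇔splits c side) split
    where
    sides-of-edge : side a ≡ true × side b ≡ false
    sides-of-edge = to (⟦⟧-diff-one (side a) (side b)) (trans (sym (split a b)) a-beats-b)
    a-in : side a ≡ true
    a-in = proj₁ sides-of-edge
    b-out : side b ≡ false
    b-out = proj₂ sides-of-edge

mainTheorem8 : (n : ℕ) → 3 ≤ n → (c : PartialChoice n) → Imbalanced c →
    Partisan c ⇔ (OnLineParallelToDiagonal (InV c (+ 1)) × OnDiagonal (InV c (+ 0)))
mainTheorem8 n _ c imbalanced = mk⇔ geometry-of-partisan partisan-of-geometry
  where
  geometry-of-partisan : Partisan c → OnLineParallelToDiagonal (InV c (+ 1)) × OnDiagonal (InV c (+ 0))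
  geometry-of-partisan (Ws , _ , _ , wins) = V₁-line , V₀-diagonal
    where open SplitGeometry c Ws (to (partisan⇔splits c Ws) wins)

  partisan-of-geometry : OnLineParallelToDiagonal (InV c (+ 1)) × OnDiagonal (InV c (+ 0)) → Partisan c
  partisan-of-geometry ((d , V₁-line) , V₀-diagonal) = Converse.partisan c imbalanced d V₁-line V₀-diagonal
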